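{- Let $\Gamma$ be a set of formulas of the language $\mathcal{L}$ of $LET_F$ and $A$ a formula. Then $\Gamma \vdash A$ (there is a closed $LET_F$-tableau for $\{1(B) : B \in \Gamma\} \cup \{0(A)\}$) if and only if there is a finite subset $\Gamma_0 \subseteq \Gamma$ such that $\Gamma_0 \vdash A$.
   Context: The language $\mathcal{L}$ of $LET_F$ has denumerably many propositional letters $p_1,p_2,\dots$, unary connectives $\circ$, $\bullet$, $\neg$, binary connectives $\wedge,\vee$; formulas are built in the usual way. A signed formula is $1(F)$ or $0(F)$ for a formula $F$. The $LET_F$ tableau rules are (each written premise $\Rightarrow$ conclusions; "$\mid$" marks a branching into two branches): R1: $1(A\wedge B) \Rightarrow 1(A), 1(B)$. R2: $0(A\wedge B) \Rightarrow 0(A) \mid 0(B)$. R3: $1(\neg(A\wedge B)) \Rightarrow 1(\neg A) \mid 1(\neg B)$. R4: $0(\neg(A\wedge B)) \Rightarrow 0(\neg A), 0(\neg B)$. R5: $1(A\vee B) \Rightarrow 1(A) \mid 1(B)$. R6: $0(A\vee B) \Rightarrow 0(A), 0(B)$. R7: $1(\neg(A\vee B)) \Rightarrow 1(\neg A), 1(\neg B)$. R8: $0(\neg(A\vee B)) \Rightarrow 0(\neg A) \mid 0(\neg B)$. R9: $1(\neg\neg A) \Rightarrow 1(A)$. R10: $0(\neg\neg A) \Rightarrow 0(A)$. R11: $1(\circ A) \Rightarrow 1(A), 0(\neg A) \mid 0(A), 1(\neg A)$. R12: $1(\bullet A) \Rightarrow 0(\circ A)$. R13: $0(\bullet A) \Rightarrow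 1(\circ A)$. There are no other rules. A tableau for a set $\Delta$ of signed formulas is a tree whose first node contains all signed formulas of $\Delta$ and whose subsequent nodes are obtained by applying these rules to signed formulas on the branch (appending the conclusions, splitting the branch for branching rules). A branch is closed if it contains $1(F)$ and $0(F)$ for some formula $F$; a tableau is closed if all its branches are closed. $\Gamma \vdash A$ means there is a closed tableau for $\{1(B): B\in\Gamma\}\cup\{0(A)\}$ (for empty $\Gamma$, a tableau for $\{0(A)\}$). -}

module Defs where

open import Data.Nat using (ℕ)
open import Data.Sum using (_⊎_)
open import Data.Product using (∃; _×_)
open import Data.List using (List)
open import Data.List.Membership.Propositional using (_∈_)
open import Relation.Binary.PropositionalEquality using (_≡_)
open import Relation.Unary using (Pred)
open import Level using (0ℓ)

infixr 6 _∧_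
infixr 5 _∨_
data Formula : Set where
  p    : ℕ → Formula
  ○_   : Formula → Formula
  ●_   : Formula → Formula
  ¬_   : Formula → Formula
  _∧_  : Formula → Formula → Formula
  _∨_  : Formula → Formula → Formula

data SFormula : Set where
  𝟙 : Formula → SFormula
  𝟘 : Formula → SFormula

SSet : Set₁
SSet = Pred SFormula 0ℓ

_⨾_ : SSet → SFormula → SSet
(S ⨾ x) y = S y ⊎ y ≡ x

-- ClosedTab S : there is a closed LET_F-tableau whose first node contains
-- (all of) S.  Each constructor corresponds to the root node: either the
-- branch is already closed, or a rule is applied to a premise on the branch,
-- the conclusions appended (with a split for branching rules), and each
-- resulting branch is in turn extended to a closed (finite) tableau.
data ClosedTab (S : SSet) : Set₁ where
  close : ∀ {F} → S (𝟙 F) → S (𝟘 F) → ClosedTab S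
  r1  : ∀ {A B} → S (𝟙 (A ∧ B)) → ClosedTab ((S ⨾ 𝟙 A) ⨾ 𝟙 B) → ClosedTab S
  r2  : ∀ {A B} → S (𝟘 (A ∧ B)) → ClosedTab (S ⨾ 𝟘 A) → ClosedTab (S ⨾ 𝟘 B) → ClosedTab S
  r3  : ∀ {A B} → S (𝟙 (¬ (A ∧ B))) → ClosedTab (S ⨾ 𝟙 (¬ A)) → ClosedTab (S ⨾ 𝟙 (¬ B)) → ClosedTab S
  r4  : ∀ {A B} → S (𝟘 (¬ (A ∧ B))) → ClosedTab ((S ⨾ 𝟘 (¬ A)) ⨾ 𝟘 (¬ B)) → ClosedTab S
  r5  : ∀ {A B} → S (𝟙 (A ∨ B)) → ClosedTab (S ⨾ 𝟙 A) → ClosedTab (S ⨾ 𝟙 B) → ClosedTab S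
  r6  : ∀ {A B} → S (𝟘 (A ∨ B)) → ClosedTab ((S ⨾ 𝟘 A) ⨾ 𝟘 B) → ClosedTab S
  r7  : ∀ {A B} → S (𝟙 (¬ (A ∨ B))) → ClosedTab ((S ⨾ 𝟙 (¬ A)) ⨾ 𝟙 (¬ B)) → ClosedTab S
  r8  : ∀ {A B} → S (𝟘 (¬ (A ∨ B))) → ClosedTab (S ⨾ 𝟘 (¬ A)) → ClosedTab (S ⨾ 𝟘 (¬ B)) → ClosedTab S
  r9  : ∀ {A} → S (𝟙 (¬ (¬ A))) → ClosedTab (S ⨾ 𝟙 A) → ClosedTab S
  r10 : ∀ {A} → S (𝟘 (¬ (¬ A))) → ClosedTab (S ⨾ 𝟘 A) → ClosedTab S
  r11 : ∀ {A} → S (𝟙 (○ A)) → ClosedTab ((S ⨾ 𝟙 A) ⨾ 𝟘 (¬ A))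
                           → ClosedTab ((S ⨾ 𝟘 A) ⨾ 𝟙 (¬ A)) → ClosedTab S
  r12 : ∀ {A} → S (𝟙 (● A)) → ClosedTab (S ⨾ 𝟘 (○ A)) → ClosedTab S
  r13 : ∀ {A} → S (𝟘 (● A)) → ClosedTab (S ⨾ 𝟙 (○ A)) → ClosedTab S

FSet : Set₁
FSet = Pred Formula 0ℓ

initial : FSet → Formula → SSet
initial Γ A s = (∃ λ B → Γ B × s ≡ 𝟙 B) ⊎ s ≡ 𝟘 A

_⊢_ : FSet → Formula → Set₁
Γ ⊢ A = ClosedTab (initial Γ A)

listSet : List Formula → FSet
listSet xs B = B ∈ xs

-- A closed tableau is a finite tree, so it uses only finitely many signed formulas of its
-- root node.  More precisely, every closed tableau for S has a finite support K ⊆ S such that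
-- every superset of K has a closed tableau: at a rule application, the supports of the
-- subtrees minus the conclusions added there, together with the premise, form a support.
-- For the initial node of Γ ⊢ A, the 1-signed formulas of a support form Γ₀; the converse
-- direction is weakening, itself a consequence of finite support.
module Submission where

open import Defs
open import Data.Product using (Σ; _×_; _,_)
open import Data.Sum using (inj₁; inj₂)
open import Data.List using (List; []; _∷_; _++_)
open import Data.List.Membership.Propositional using (_∈_)
open import Data.List.Relation.Unary.All as All using (All; []; _∷_)
open import Data.List.Relation.Unary.All.Properties using (++⁺; ++⁻)
open import Data.List.Relation.Unary.Any using (here; there)
open import Relation.Binary.PropositionalEquality using (refl)
open import Relation.Unary using (_⊆_)
open import Function.Bundles using (_⇔_; mk⇔)

⨾-mono : ∀ {S T a} → S ⊆ T → (S ⨾ a) ⊆ (T ⨾ a)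
⨾-mono S⊆T (inj₁ Sy) = inj₁ (S⊆T Sy)
⨾-mono S⊆T (inj₂ y≡a) = inj₂ y≡a

split-⨾ : ∀ {S a L} → All (S ⨾ a) L →
          Σ (List SFormula) λ K → All S K × (∀ {T} → All T K → All (T ⨾ a) L)
split-⨾ [] = [] , [] , λ _ → []
split-⨾ (inj₁ Sx ∷ L⊆S⨾a) with split-⨾ L⊆S⨾a
... | K , K⊆S , ⨾a-cover = _ ∷ K , Sx ∷ K⊆S , λ { (Tx ∷ K⊆T) → inj₁ Tx ∷ ⨾a-cover K⊆T }
split-⨾ (inj₂ refl ∷ L⊆S⨾a) with split-⨾ L⊆S⨾a
... | K , K⊆S , ⨾a-cover = K , K⊆S , λ K⊆T → inj₂ refl ∷ ⨾a-cover K⊆T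

-- f T is the branch below the root obtained by appending the conclusions of the rule to T.
record FinitelySupported (f : SSet → SSet) (S : SSet) : Set₁ where
  constructor support
  field
    elements : List SFormula
    elements⊆ : All S elements
    closes : ∀ {T} → All T elements → ClosedTab (f T)

drop-⨾ : ∀ {f S a} → FinitelySupported f (S ⨾ a) → FinitelySupported (λ T → f (T ⨾ a)) S
drop-⨾ (support L L⊆S⨾a closes) with split-⨾ L⊆S⨾a
... | K , K⊆S , ⨾a-cover = support K K⊆S (λ K⊆T → closes (⨾a-cover K⊆T))

unaryRule : ∀ {f S x} → S x → (∀ {T} → T x → ClosedTab (f T) → ClosedTab T) →
            FinitelySupported f S → FinitelySupported (λ T → T) S
unaryRule Sx rule (support K K⊆S closes) =
  support (_ ∷ K) (Sx ∷ K⊆S) λ { (Tx ∷ K⊆T) → rule Tx (closes K⊆T) }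

binaryRule : ∀ {f g S x} → S x → (∀ {T} → T x → ClosedTab (f T) → ClosedTab (g T) → ClosedTab T) →
             FinitelySupported f S → FinitelySupported g S → FinitelySupported (λ T → T) S
binaryRule Sx rule (support K K⊆S closesₖ) (support L L⊆S closesₗ) =
  support (_ ∷ K ++ L) (Sx ∷ ++⁺ K⊆S L⊆S) λ { (Tx ∷ K++L⊆T) → closeBoth Tx (++⁻ K K++L⊆T) }
  where
  closeBoth : ∀ {T} → T _ → All T K × All T L → ClosedTab T
  closeBoth Tx (K⊆T , L⊆T) = rule Tx (closesₖ K⊆T) (closesₗ L⊆T)

finitelySupported : ∀ {S} → ClosedTab S → FinitelySupported (λ T → T) S
finitelySupported (close S1F S0F) =
  support (_ ∷ _ ∷ []) (S1F ∷ S0F ∷ []) λ { (T1F ∷ T0F ∷ []) → close T1F T0F }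
finitelySupported (r1 x t) = unaryRule x r1 (drop-⨾ (drop-⨾ (finitelySupported t)))
finitelySupported (r2 x t u) = binaryRule x r2 (drop-⨾ (finitelySupported t)) (drop-⨾ (finitelySupported u))
finitelySupported (r3 x t u) = binaryRule x r3 (drop-⨾ (finitelySupported t)) (drop-⨾ (finitelySupported u))
finitelySupported (r4 x t) = unaryRule x r4 (drop-⨾ (drop-⨾ (finitelySupported t)))
finitelySupported (r5 x t u) = binaryRule x r5 (drop-⨾ (finitelySupported t)) (drop-⨾ (finitelySupported u))
finitelySupported (r6 x t) = unaryRule x r6 (drop-⨾ (drop-⨾ (finitelySupported t)))
finitelySupported (r7 x t) = unaryRule x r7 (drop-⨾ (drop-⨾ (finitelySupported t)))
finitelySupported (r8 x t u) = binaryRule x r8 (drop-⨾ (finitelySupported t)) (drop-⨾ (finitelySupported u))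
finitelySupported (r9 x t) = unaryRule x r9 (drop-⨾ (finitelySupported t))
finitelySupported (r10 x t) = unaryRule x r10 (drop-⨾ (finitelySupported t))
finitelySupported (r11 x t u) =
  binaryRule x r11 (drop-⨾ (drop-⨾ (finitelySupported t))) (drop-⨾ (drop-⨾ (finitelySupported u)))
finitelySupported (r12 x t) = unaryRule x r12 (drop-⨾ (finitelySupported t))
finitelySupported (r13 x t) = unaryRule x r13 (drop-⨾ (finitelySupported t))

ClosedTab-mono : ∀ {S T} → S ⊆ T → ClosedTab S → ClosedTab T
ClosedTab-mono S⊆T t with finitelySupported t
... | support K K⊆S closes = closes (All.map S⊆T K⊆S)

initial-mono : ∀ {Γ Δ A} → Γ ⊆ Δ → initial Γ A ⊆ initial Δ A
initial-mono Γ⊆Δ (inj₁ (B , ΓB , refl)) = inj₁ (B , Γ⊆Δ ΓB , refl)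
initial-mono Γ⊆Δ (inj₂ refl) = inj₂ refl

finitePremises : ∀ {Γ A K} → All (initial Γ A) K →
                 Σ (List Formula) λ Γ₀ → All Γ Γ₀ × All (initial (listSet Γ₀) A) K
finitePremises [] = [] , [] , []
finitePremises (inj₁ (B , ΓB , refl) ∷ K⊆initial) with finitePremises K⊆initial
... | Γ₀ , Γ₀⊆Γ , K⊆initial₀ =
  B ∷ Γ₀ , ΓB ∷ Γ₀⊆Γ , inj₁ (B , here refl , refl) ∷ All.map (initial-mono there) K⊆initial₀
finitePremises (inj₂ refl ∷ K⊆initial) with finitePremises K⊆initial
... | Γ₀ , Γ₀⊆Γ , K⊆initial₀ = Γ₀ , Γ₀⊆Γ , inj₂ refl ∷ K⊆initial₀

theorem6 : (Γ : FSet) (A : Formula) →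
    (Γ ⊢ A) ⇔ (Σ (List Formula) λ Γ₀ → (∀ B → B ∈ Γ₀ → Γ B) × (listSet Γ₀ ⊢ A))
theorem6 Γ A = mk⇔ compact weaken
  where
  compact : Γ ⊢ A → Σ (List Formula) λ Γ₀ → (∀ B → B ∈ Γ₀ → Γ B) × (listSet Γ₀ ⊢ A)
  compact t with finitelySupported t
  ... | support K K⊆initial closes with finitePremises K⊆initial
  ... | Γ₀ , Γ₀⊆Γ , K⊆initial₀ = Γ₀ , (λ _ → All.lookup Γ₀⊆Γ) , closes K⊆initial₀

  weaken : (Σ (List Formula) λ Γ₀ → (∀ B → B ∈ Γ₀ → Γ B) × (listSet Γ₀ ⊢ A)) → Γ ⊢ A
  weaken (Γ₀ , Γ₀⊆Γ , t) = ClosedTab-mono (initial-mono (Γ₀⊆Γ _)) t
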